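{- Let $\mathcal{X}$ be a roux scheme on vertex set $\Omega$ with thin radical $G$. Suppose that for some vertex $x$ and some thick relation $S$ of $\mathcal{X}$, the restrictions of the relations of $\mathcal{X}$ to $S(x)$ form a local association scheme $\mathcal{Y}$ with $|G|$ classes. Then $\mathcal{X}=\mathcal{Y}\widehat\otimes G$; that is, the non-diagonal relations of $\mathcal{Y}$ can be labelled $R_g$ ($g\in G$) with $R_g^\top=R_{g^{ -1}}$ such that $\mathcal{X}$ is isomorphic to the scheme on $(S(x)\cup\{\infty\})\times G$ whose adjacency matrices are \[ \mathsf{T}_k=\mathsf{I}\otimes\mathsf{P}_k,\qquad \mathsf{S}_k=\sum_{\ell\in G}\widetilde{\mathsf{A}}_\ell\otimes\mathsf{P}_{k\ell}\qquad(k\in G). \]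
   Context: Association schemes are commutative (partition of $\Omega\times\Omega$ into relations including the identity, closed under transpose, with intersection numbers $p_{ij}^k=p_{ji}^k$). Thin relations have valency $1$ and form a group (the thin radical) under product of adjacency matrices; the others are thick. A roux scheme is obtained from a roux matrix $\mathsf{B}$ (square matrix over $\mathbb{C}[G]$, $G$ abelian, zero diagonal, off-diagonal entries in $G$, $\mathsf{B}_{ji}=\mathsf{B}_{ij}^{ -1}$, with $\{g\mathsf{I}\}\cup\{g\mathsf{B}\}$ spanning an algebra) by applying the regular permutation representation of $G$ entrywise to $g\mathsf{I},g\mathsf{B}$ ($g\in G$); up to isomorphism these are the commutative schemes whose thin radical acts regularly by multiplication on thick adjacency matrices and which have a symmetric thick relation. For a relation $S$ and vertex $x$, $S(x)=\{y:(x,y)\in S\}$; the local scheme on $S(x)$ has as relations the nonempty restrictions $R\cap(S(x)\times S(x))$. For $k\in G$, $\mathsf{P}_k$ is the $G\times G$ permutation matrix with $(\mathsf{P}_k)_{g,h}=\delta_{gk,h}$. With $\mathsf{A}_g$ the adjacency matrix of $R_g$ on $S(x)$, the first row and column indexed by the extra point $\infty$, and $\mathbf{1}$ the all-ones row vector: $\widetilde{\mathsf{A}}_1=\begin{bmatrix}0&\mathbf{1}\\ \mathbf{1}^\top&\mathsf{A}_1\end{bmatrix}$ and $\widetilde{\mathsf{A}}_g=\begin{bmatrix}0&0\\0&\mathsf{A}_g\end{bmatrix}$ for $g\neq1$. -}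

module Defs where

open import Data.Nat using (ℕ; zero; suc; _+_; _*_; _≡ᵇ_)
open import Data.Integer using (ℤ; 0ℤ; 1ℤ) renaming (_+_ to _+ℤ_; _*_ to _*ℤ_)
open import Data.Fin using (Fin; zero; suc)
import Data.Fin.Properties as FinP
open import Data.Bool using (Bool; true; false; if_then_else_; _∧_; not)
open import Data.Sum using (_⊎_; inj₁; inj₂)
import Data.Sum.Properties as SumP
open import Data.Product using (Σ; _×_; _,_; proj₁; proj₂; ∃; ∃-syntax)
import Data.Product.Properties as ProdP
open import Data.Maybe using (Maybe; just; nothing)
open import Relation.Nullary using (¬_; Dec; yes; no)
open import Relation.Nullary.Decidable using (⌊_⌋)
open import Relation.Binary.PropositionalEquality using (_≡_; _≢_)
open import Algebra.Structures using (IsAbelianGroup)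
open import Function.Bundles using (_↔_; Inverse)

sumℕ : (n : ℕ) → (Fin n → ℕ) → ℕ
sumℕ zero    f = 0
sumℕ (suc n) f = f zero + sumℕ n (λ i → f (suc i))

sumℤ : (n : ℕ) → (Fin n → ℤ) → ℤ
sumℤ zero    f = 0ℤ
sumℤ (suc n) f = f zero +ℤ sumℤ n (λ i → f (suc i))

count : (n : ℕ) → (Fin n → Bool) → ℕ
count n P = sumℕ n (λ i → if P i then 1 else 0)

-- A finite abelian group, with carrier Fin k (any finite abelian group
-- is isomorphic to one of this form).

record FinAbGroup (k : ℕ) : Set where
  field
    _∙_ : Fin k → Fin k → Fin k
    ε   : Fin k
    _⁻¹ : Fin k → Fin k
    isAbelianGroup : IsAbelianGroup _≡_ _∙_ ε _⁻¹

-- Roux matrices and roux schemes.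
-- B : Fin m → Fin m → Fin k gives the off-diagonal entries B_ij ∈ G
-- (i ≢ j); the diagonal of the roux matrix is 0 ∈ ℂ[G] and the values
-- B i i are never used.

module Roux {m k : ℕ} (G : FinAbGroup k) (B : Fin m → Fin m → Fin k) where
  open FinAbGroup G

  GR : Set
  GR = Fin k → ℤ

  0GR : GR
  0GR _ = 0ℤ

  δ : Fin k → GR
  δ g h = if ⌊ g FinP.≟ h ⌋ then 1ℤ else 0ℤ

  _⋆_ : GR → GR → GR
  (f ⋆ h) g = sumℤ k (λ a → sumℤ k (λ b →
                 if ⌊ (a ∙ b) FinP.≟ g ⌋ then f a *ℤ h b else 0ℤ))

  𝖡 : Fin m → Fin m → GR
  𝖡 i j = if ⌊ i FinP.≟ j ⌋ then 0GR else δ (B i j)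

  𝖨 : Fin m → Fin m → GR
  𝖨 i j = if ⌊ i FinP.≟ j ⌋ then δ ε else 0GR

  𝖡² : Fin m → Fin m → GR
  𝖡² i j g = sumℤ m (λ l → (𝖡 i l ⋆ 𝖡 l j) g)

  -- {g𝖨} ∪ {g𝖡} spans an algebra: the span {α𝖨 + β𝖡 : α, β ∈ ℤ[G]}
  -- contains 𝖨 and is closed under products, i.e. 𝖡² lies in it.
  SpansAlgebra : Set
  SpansAlgebra = ∃[ α ] ∃[ β ] (∀ i j g →
                   𝖡² i j g ≡ (α ⋆ 𝖨 i j) g +ℤ (β ⋆ 𝖡 i j) g)

  IsRouxMatrix : Set
  IsRouxMatrix = (∀ i j → i ≢ j → B j i ≡ (B i j) ⁻¹) × SpansAlgebra

  -- The roux scheme 𝒳: vertices Ω = Fin m × G, relations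
  --   inj₁ g  : support of g𝖨 (i.e. 𝖨 ⊗ 𝖯_g)     (thin radical)
  --   inj₂ g  : support of g𝖡
  -- ((i,a),(j,b)) ∈ support of g𝖡  iff  i ≢ j and b = a g B_ij.

  Vtx : Set
  Vtx = Fin m × Fin k

  Col : Set
  Col = Fin k ⊎ Fin k

  _≟V_ : (u v : Vtx) → Dec (u ≡ v)
  _≟V_ = ProdP.≡-dec FinP._≟_ FinP._≟_

  _≟C_ : (c d : Col) → Dec (c ≡ d)
  _≟C_ = SumP.≡-dec FinP._≟_ FinP._≟_

  col : Vtx → Vtx → Col
  col (i , a) (j , b) with i FinP.≟ j
  ... | yes _ = inj₁ ((a ⁻¹) ∙ b)
  ... | no  _ = inj₂ (((a ⁻¹) ∙ b) ∙ ((B i j) ⁻¹))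

  AX : Col → Vtx → Vtx → ℕ
  AX c u v = if ⌊ col u v ≟C c ⌋ then 1 else 0

  sumV : (Vtx → ℕ) → ℕ
  sumV f = sumℕ m (λ i → sumℕ k (λ a → f (i , a)))

  countV : (Vtx → Bool) → ℕ
  countV P = sumV (λ v → if P v then 1 else 0)

  countC : (Col → Bool) → ℕ
  countC P = count k (λ g → P (inj₁ g)) + count k (λ g → P (inj₂ g))

  valency : Col → Vtx → ℕ
  valency c x = countV (λ y → ⌊ col x y ≟C c ⌋)

  Thin : Col → Set
  Thin c = ∀ x → valency c x ≡ 1

  Thick : Col → Set
  Thick c = ¬ Thin c

  module Local (x : Vtx) (s : Col) where

    inS : Vtx → Bool
    inS y = ⌊ col x y ≟C s ⌋

    countS : (Vtx → Bool) → ℕ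
    countS P = countV (λ z → inS z ∧ P z)

    -- |c ∩ (S(x) × S(x))|; the restriction of c is a relation of 𝒴
    -- iff this is nonzero
    pairs : Col → ℕ
    pairs c = sumV (λ y → if inS y then countS (λ z → ⌊ col y z ≟C c ⌋) else 0)

    p : Col → Col → Vtx → Vtx → ℕ
    p i j y w = countS (λ z → ⌊ col y z ≟C i ⌋ ∧ ⌊ col z w ≟C j ⌋)

    IsLocalScheme : Set
    IsLocalScheme =
      (∃[ c ] ∀ y z → inS y ≡ true → inS z ≡ true → (col y z ≡ c → y ≡ z) × (y ≡ z → col y z ≡ c))
      × (∀ c → ∃[ c' ] ∀ y z → inS y ≡ true → inS z ≡ true → col y z ≡ c → col z y ≡ c')
      × (∀ i j c → ∃[ n ] ∀ y w → inS y ≡ true → inS w ≡ true → col y w ≡ c → p i j y w ≡ n)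
      × (∀ i j y w → inS y ≡ true → inS w ≡ true → p i j y w ≡ p j i y w)

    -- number of classes of 𝒴 (non-identity relations); the identity
    -- relation of S(x) is the restriction of inj₁ ε
    classes : ℕ
    classes = countC (λ c → not ⌊ c ≟C inj₁ ε ⌋ ∧ not (pairs c ≡ᵇ 0))

    IsLabelling : (Fin k → Col) → Set
    IsLabelling L =
      (∀ g h → L g ≡ L h → g ≡ h)
      × (∀ g → L g ≢ inj₁ ε × pairs (L g) ≢ 0)
      × (∀ c → c ≢ inj₁ ε → pairs c ≢ 0 → ∃[ g ] L g ≡ c)
      × (∀ g y z → inS y ≡ true → inS z ≡ true → col y z ≡ L g → col z y ≡ L (g ⁻¹))

    -- points of S(x) ∪ {∞}  (nothing = ∞)
    SX : Set
    SX = Σ Vtx (λ y → inS y ≡ true)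

    Pt : Set
    Pt = Maybe SX

    W : Set
    W = Pt × Fin k

    module Target (L : Fin k → Col) where

      Im : Pt → Pt → ℕ
      Im nothing        nothing        = 1
      Im nothing        (just _)       = 0
      Im (just _)       nothing        = 0
      Im (just (y , _)) (just (z , _)) = if ⌊ y ≟V z ⌋ then 1 else 0

      Ã : Fin k → Pt → Pt → ℕ
      Ã ℓ nothing        nothing        = 0
      Ã ℓ nothing        (just _)       = if ⌊ ℓ FinP.≟ ε ⌋ then 1 else 0
      Ã ℓ (just _)       nothing        = if ⌊ ℓ FinP.≟ ε ⌋ then 1 else 0
      Ã ℓ (just (y , _)) (just (z , _)) = if ⌊ col y z ≟C L ℓ ⌋ then 1 else 0

      P : Fin k → Fin k → Fin k → ℕ
      P g a b = if ⌊ (a ∙ g) FinP.≟ b ⌋ then 1 else 0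

      T : Fin k → W → W → ℕ
      T g (u , a) (v , b) = Im u v * P g a b

      S : Fin k → W → W → ℕ
      S g (u , a) (v , b) = sumℕ k (λ ℓ → Ã ℓ u v * P (g ∙ ℓ) a b)

      M : Col → W → W → ℕ
      M (inj₁ g) = T g
      M (inj₂ g) = S g

    IsoToTensor : Set
    IsoToTensor =
      ∃[ L ] IsLabelling L ×
        (Σ (Vtx ↔ W) λ φ → Σ (Col ↔ Col) λ ψ →
          ∀ c u v → AX c u v ≡ Target.M L (Inverse.to ψ c) (Inverse.to φ u) (Inverse.to φ v))

-- Write x = (i , a) and S for the support of g₀𝖡.  Then
-- S(x) = {(j , a g₀ B_ij) : j ≢ i} has exactly one point in each fibre
-- {j} × G with j ≢ i, so S(x) ∪ {∞} indexes the fibres, ∞ being the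
-- fibre of x.  Identify (i , b) with (∞ , b) and, for j ≢ i, (j , b)
-- with (the point over j , b B_ij⁻¹).  Within a fibre the relation g𝖨
-- becomes 𝖨 ⊗ 𝖯_g; between the fibres of p ≢ q the relation g𝖡 becomes
-- 𝖯_gℓ, where ℓ = B_ij B_jl B_il⁻¹ for the points over j and l, and
-- ℓ = ε when p or q is ∞ (as B_ji = B_ij⁻¹).  Since the points over j
-- and l are related by ℓ⁻¹𝖡, this is Σ_ℓ 𝖠̃_ℓ ⊗ 𝖯_gℓ for the labelling
-- g ↦ g⁻¹𝖡.  The class count |G| rules out thin S and forces every
-- g⁻¹𝖡 to meet S(x) × S(x), so the labelling is onto the classes of 𝒴.

module Submission where

open import Defs
open import Level using (0ℓ)
open import Data.Nat using (ℕ; zero; suc; _+_; _*_; _≤_; z≤n; s≤s; _≡ᵇ_)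
open import Data.Nat.Properties using (*-identityˡ; +-identityʳ; m≤n⇒m≤1+n; suc-injective; <⇒≢)
open import Data.Fin using (Fin; zero; suc)
open import Data.Fin.Properties using (_≟_; ¬Fin0)
import Data.Fin.Properties as Fin
open import Data.Bool using (Bool; true; false; if_then_else_; _∧_; not)
import Data.Bool.Properties as Bool
open import Data.Sum using (inj₁; inj₂)
open import Data.Sum.Properties using (inj₁-injective; inj₂-injective)
open import Data.Product using (_×_; _,_; proj₁; proj₂; ∃-syntax)
open import Data.Maybe using (just; nothing)
open import Function using (_∘_)
open import Function.Bundles using (_⇔_; mk⇔; Equivalence; mk↔ₛ′)
open import Function.Construct.Composition using (_⇔-∘_)
open import Function.Construct.Identity using (↔-id)
open import Relation.Nullary using (¬_; Dec; yes; no; contradiction)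
open import Relation.Nullary.Decidable using (⌊_⌋)
open import Relation.Binary.PropositionalEquality
  using (_≡_; _≢_; refl; sym; trans; cong; cong₂; subst; module ≡-Reasoning)
open import Axiom.UniquenessOfIdentityProofs using (module Decidable⇒UIP)
open import Algebra.Bundles using (AbelianGroup)
import Algebra.Properties.AbelianGroup as AbelianGroupProperties

open Equivalence using (to; from)
open ≡-Reasoning

𝟙 : ∀ {p} {P : Set p} → Dec P → ℕ
𝟙 P? = if ⌊ P? ⌋ then 1 else 0

𝟙-yes : ∀ {p} {P : Set p} (P? : Dec P) → P → 𝟙 P? ≡ 1
𝟙-yes (yes _) _ = refl
𝟙-yes (no ¬p) p = contradiction p ¬p

𝟙-no : ∀ {p} {P : Set p} (P? : Dec P) → ¬ P → 𝟙 P? ≡ 0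
𝟙-no (yes p) ¬p = contradiction p ¬p
𝟙-no (no _)  _  = refl

𝟙-⇔ : ∀ {p q} {P : Set p} {Q : Set q} → P ⇔ Q → (P? : Dec P) (Q? : Dec Q) → 𝟙 P? ≡ 𝟙 Q?
𝟙-⇔ P⇔Q (yes p) Q? = sym (𝟙-yes Q? (to P⇔Q p))
𝟙-⇔ P⇔Q (no ¬p) Q? = sym (𝟙-no Q? (¬p ∘ from P⇔Q))

⌊⌋≡true⇔ : ∀ {p} {P : Set p} (P? : Dec P) → ⌊ P? ⌋ ≡ true ⇔ P
⌊⌋≡true⇔ (yes p) = mk⇔ (λ _ → p) (λ _ → refl)
⌊⌋≡true⇔ (no ¬p) = mk⇔ (λ ()) (λ p → contradiction p ¬p)

sumℕ-cong : ∀ n {f g : Fin n → ℕ} → (∀ i → f i ≡ g i) → sumℕ n f ≡ sumℕ n g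
sumℕ-cong zero    f≗g = refl
sumℕ-cong (suc n) f≗g = cong₂ _+_ (f≗g zero) (sumℕ-cong n (f≗g ∘ suc))

sumℕ-zero : ∀ n (f : Fin n → ℕ) → (∀ i → f i ≡ 0) → sumℕ n f ≡ 0
sumℕ-zero zero    f f≡0 = refl
sumℕ-zero (suc n) f f≡0 = cong₂ _+_ (f≡0 zero) (sumℕ-zero n (f ∘ suc) (f≡0 ∘ suc))

sumℕ-select : ∀ n (f : Fin n → ℕ) i₀ → (∀ i → i ≢ i₀ → f i ≡ 0) → sumℕ n f ≡ f i₀
sumℕ-select (suc n) f zero f≡0 =
  trans (cong (f zero +_) (sumℕ-zero n (f ∘ suc) (λ i → f≡0 (suc i) (λ ())))) (+-identityʳ (f zero))
sumℕ-select (suc n) f (suc i₀) f≡0 =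
  cong₂ _+_ (f≡0 zero (λ ()))
            (sumℕ-select n (f ∘ suc) i₀ (λ i i≢i₀ → f≡0 (suc i) (i≢i₀ ∘ Fin.suc-injective)))

sumℕ-𝟙 : ∀ n (f : Fin n → ℕ) i₀ → sumℕ n (λ i → 𝟙 (i ≟ i₀) * f i) ≡ f i₀
sumℕ-𝟙 n f i₀ = begin
  sumℕ n (λ i → 𝟙 (i ≟ i₀) * f i)
    ≡⟨ sumℕ-select n _ i₀ (λ i i≢i₀ → cong (_* f i) (𝟙-no (i ≟ i₀) i≢i₀)) ⟩
  𝟙 (i₀ ≟ i₀) * f i₀
    ≡⟨ cong (_* f i₀) (𝟙-yes (i₀ ≟ i₀) refl) ⟩
  1 * f i₀
    ≡⟨ *-identityˡ (f i₀) ⟩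
  f i₀ ∎

count-zero : ∀ n (P : Fin n → Bool) → (∀ i → P i ≡ false) → count n P ≡ 0
count-zero n P P≡false = sumℕ-zero n _ (λ i → cong (λ b → if b then 1 else 0) (P≡false i))

count≤n : ∀ n (P : Fin n → Bool) → count n P ≤ n
count≤n zero    P = z≤n
count≤n (suc n) P with P zero
... | true  = s≤s (count≤n n (P ∘ suc))
... | false = m≤n⇒m≤1+n (count≤n n (P ∘ suc))

count≡n⇒all : ∀ n (P : Fin n → Bool) → count n P ≡ n → ∀ i → P i ≡ true
count≡n⇒all (suc n) P count≡n i with P zero in P₀
... | false = contradiction count≡n (<⇒≢ (s≤s (count≤n n (P ∘ suc))))
count≡n⇒all (suc n) P count≡n zero    | true = P₀
count≡n⇒all (suc n) P count≡n (suc i) | true = count≡n⇒all n (P ∘ suc) (suc-injective count≡n) i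

abelianGroup : ∀ {k} → FinAbGroup k → AbelianGroup 0ℓ 0ℓ
abelianGroup G = record { isAbelianGroup = FinAbGroup.isAbelianGroup G }

module FinAbGroupProperties {k : ℕ} (G : FinAbGroup k) where
  open AbelianGroup (abelianGroup G) public
    using (_∙_; ε; _⁻¹; assoc; identityʳ; inverseˡ; inverseʳ; ∙-congˡ; ∙-congʳ)
  open AbelianGroupProperties (abelianGroup G) public
    using (⁻¹-involutive; ⁻¹-injective; identityʳ-unique; ε⁻¹≈ε; //-rightDividesˡ; //-rightDividesʳ)
  open AbelianGroupProperties (abelianGroup G)
    using (\\-leftDividesˡ; y≈x\\z; ∙-cancelʳ; ⁻¹-anti-homo-//)
  open import Algebra.Properties.CommutativeSemigroup
    (AbelianGroup.commutativeSemigroup (abelianGroup G)) public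
    using (xy∙z≈xz∙y)
  open import Algebra.Solver.CommutativeMonoid (AbelianGroup.commutativeMonoid (abelianGroup G))
    using (solve; _⊜_; _⊕_)

  x⁻¹∙z≡y⇔x∙y≡z : ∀ x y z → x ⁻¹ ∙ z ≡ y ⇔ x ∙ y ≡ z
  x⁻¹∙z≡y⇔x∙y≡z x y z =
    mk⇔ (λ e → trans (∙-congˡ (sym e)) (\\-leftDividesˡ x z)) (λ e → sym (y≈x\\z x y z e))

  x∙y⁻¹≡z⇔x≡z∙y : ∀ x y z → x ∙ y ⁻¹ ≡ z ⇔ x ≡ z ∙ y
  x∙y⁻¹≡z⇔x≡z∙y x y z =
    mk⇔ (λ e → trans (sym (//-rightDividesˡ y x)) (∙-congʳ e))
        (λ e → trans (∙-congʳ e) (//-rightDividesʳ y z))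

  x⁻¹∙z∙w⁻¹≡y⇔x∙y∙w≡z : ∀ x y z w → x ⁻¹ ∙ z ∙ w ⁻¹ ≡ y ⇔ x ∙ y ∙ w ≡ z
  x⁻¹∙z∙w⁻¹≡y⇔x∙y∙w≡z x y z w = mk⇔
    (λ e → trans (assoc x y w) (to (x⁻¹∙z≡y⇔x∙y≡z x (y ∙ w) z) (to (x∙y⁻¹≡z⇔x≡z∙y _ w y) e)))
    (λ e → from (x∙y⁻¹≡z⇔x≡z∙y _ w y) (from (x⁻¹∙z≡y⇔x∙y≡z x (y ∙ w) z) (trans (sym (assoc x y w)) e)))

  x∙z≡y∙z⇔x≡y : ∀ x y z → x ∙ z ≡ y ∙ z ⇔ x ≡ y
  x∙z≡y∙z⇔x≡y x y z = mk⇔ (∙-cancelʳ z x y) ∙-congʳ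

  x∙y∙z∙y⁻¹∙z⁻¹≡x : ∀ x y z → x ∙ y ∙ z ∙ y ⁻¹ ∙ z ⁻¹ ≡ x
  x∙y∙z∙y⁻¹∙z⁻¹≡x x y z = begin
    x ∙ y ∙ z ∙ y ⁻¹ ∙ z ⁻¹
      ≡⟨ solve 5 (λ x y z y' z' → (((x ⊕ y) ⊕ z) ⊕ y') ⊕ z' ⊜ (x ⊕ (y ⊕ y')) ⊕ (z ⊕ z'))
               refl x y z (y ⁻¹) (z ⁻¹) ⟩
    x ∙ (y ∙ y ⁻¹) ∙ (z ∙ z ⁻¹)
      ≡⟨ cong₂ (λ u v → x ∙ u ∙ v) (inverseʳ y) (inverseʳ z) ⟩
    x ∙ ε ∙ ε
      ≡⟨ trans (identityʳ (x ∙ ε)) (identityʳ x) ⟩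
    x ∎

  x∙y∙[y∙z∙w⁻¹]⁻¹∙z≡x∙w : ∀ x y z w → x ∙ y ∙ (y ∙ z ∙ w ⁻¹) ⁻¹ ∙ z ≡ x ∙ w
  x∙y∙[y∙z∙w⁻¹]⁻¹∙z≡x∙w x y z w = begin
    x ∙ y ∙ (y ∙ z ∙ w ⁻¹) ⁻¹ ∙ z
      ≡⟨ cong (λ u → x ∙ y ∙ u ∙ z) (⁻¹-anti-homo-// (y ∙ z) w) ⟩
    x ∙ y ∙ (w ∙ (y ∙ z) ⁻¹) ∙ z
      ≡⟨ solve 5 (λ x y z w v → ((x ⊕ y) ⊕ (w ⊕ v)) ⊕ z ⊜ (x ⊕ w) ⊕ ((y ⊕ z) ⊕ v))
               refl x y z w ((y ∙ z) ⁻¹) ⟩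
    x ∙ w ∙ (y ∙ z ∙ (y ∙ z) ⁻¹)
      ≡⟨ trans (∙-congˡ (inverseʳ (y ∙ z))) (identityʳ (x ∙ w)) ⟩
    x ∙ w ∎

  x∙y∙z∙w≡x∙[z∙[y∙w∙u⁻¹]]∙u : ∀ x y z w u → x ∙ y ∙ z ∙ w ≡ x ∙ (z ∙ (y ∙ w ∙ u ⁻¹)) ∙ u
  x∙y∙z∙w≡x∙[z∙[y∙w∙u⁻¹]]∙u x y z w u = sym (begin
    x ∙ (z ∙ (y ∙ w ∙ u ⁻¹)) ∙ u
      ≡⟨ solve 6 (λ x y z w u' u → (x ⊕ (z ⊕ ((y ⊕ w) ⊕ u'))) ⊕ u ⊜ (((x ⊕ y) ⊕ z) ⊕ w) ⊕ (u' ⊕ u))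
               refl x y z w (u ⁻¹) u ⟩
    x ∙ y ∙ z ∙ w ∙ (u ⁻¹ ∙ u)
      ≡⟨ trans (∙-congˡ (inverseˡ u)) (identityʳ (x ∙ y ∙ z ∙ w)) ⟩
    x ∙ y ∙ z ∙ w ∎)

module RouxProperties {m k : ℕ} (G : FinAbGroup k) (B : Fin m → Fin m → Fin k) where
  open FinAbGroupProperties G
  open Roux G B

  col≡inj₁⇔ : ∀ {j l b c g} → col (j , b) (l , c) ≡ inj₁ g ⇔ (j ≡ l × b ∙ g ≡ c)
  col≡inj₁⇔ {j} {l} {b} {c} {g} with j ≟ l
  ... | yes j≡l = mk⇔ (λ e → j≡l , to (x⁻¹∙z≡y⇔x∙y≡z b g c) (inj₁-injective e))
                      (λ (_ , e) → cong inj₁ (from (x⁻¹∙z≡y⇔x∙y≡z b g c) e))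
  ... | no j≢l  = mk⇔ (λ ()) (λ (j≡l , _) → contradiction j≡l j≢l)

  col≡inj₂⇔ : ∀ {j l b c g} → col (j , b) (l , c) ≡ inj₂ g ⇔ (j ≢ l × b ∙ g ∙ B j l ≡ c)
  col≡inj₂⇔ {j} {l} {b} {c} {g} with j ≟ l
  ... | yes j≡l = mk⇔ (λ ()) (λ (j≢l , _) → contradiction j≡l j≢l)
  ... | no j≢l  = mk⇔ (λ e → j≢l , to (x⁻¹∙z∙w⁻¹≡y⇔x∙y∙w≡z b g c (B j l)) (inj₂-injective e))
                      (λ (_ , e) → cong inj₂ (from (x⁻¹∙z∙w⁻¹≡y⇔x∙y∙w≡z b g c (B j l)) e))

  module LocalProperties (x : Vtx) (s : Col) where
    open Local x s

    inS⇔ : ∀ {y} → inS y ≡ true ⇔ col x y ≡ s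
    inS⇔ {y} = ⌊⌋≡true⇔ (col x y ≟C s)

    pairs≡0 : ∀ c → (∀ y z → inS y ≡ true → inS z ≡ true → col y z ≢ c) → pairs c ≡ 0
    pairs≡0 c no-pair = sumℕ-zero m _ (λ j → sumℕ-zero k _ (λ b → row (j , b)))
      where
      entry : ∀ y → inS y ≡ true → ∀ z → (if inS z ∧ ⌊ col y z ≟C c ⌋ then 1 else 0) ≡ 0
      entry y y∈S z with inS z in z∈S
      ... | false = refl
      ... | true  = 𝟙-no (col y z ≟C c) (no-pair y z y∈S z∈S)

      row : ∀ y → (if inS y then countS (λ z → ⌊ col y z ≟C c ⌋) else 0) ≡ 0
      row y with inS y in y∈S
      ... | false = refl
      ... | true  = sumℕ-zero m _ (λ j → sumℕ-zero k _ (λ b → entry y y∈S (j , b)))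

    isClass : Col → Bool
    isClass c = not ⌊ c ≟C inj₁ ε ⌋ ∧ not (pairs c ≡ᵇ 0)

    isClass≡false : ∀ c → (c ≢ inj₁ ε → pairs c ≡ 0) → isClass c ≡ false
    isClass≡false c empty with c ≟C inj₁ ε
    ... | yes _   = refl
    ... | no c≢ε rewrite empty c≢ε = refl

    isClass⇒pairs≢0 : ∀ c → isClass c ≡ true → pairs c ≢ 0
    isClass⇒pairs≢0 c c-class pairs≡0 rewrite pairs≡0 =
      contradiction (trans (sym (Bool.∧-zeroʳ _)) c-class) (λ ())

    classes≡0 : (∀ c → c ≢ inj₁ ε → pairs c ≡ 0) → classes ≡ 0
    classes≡0 empty = cong₂ _+_ (count-zero k _ (λ g → isClass≡false (inj₁ g) (empty (inj₁ g))))
                                (count-zero k _ (λ g → isClass≡false (inj₂ g) (empty (inj₂ g))))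

    classes≡k⇒pairs≢0 : (∀ g → g ≢ ε → pairs (inj₁ g) ≡ 0) → classes ≡ k → ∀ g → pairs (inj₂ g) ≢ 0
    classes≡k⇒pairs≢0 empty classes≡k g =
      isClass⇒pairs≢0 (inj₂ g) (count≡n⇒all k (isClass ∘ inj₂) inj₂-classes≡k g)
      where
      inj₂-classes≡k : count k (isClass ∘ inj₂) ≡ k
      inj₂-classes≡k = trans (cong (_+ count k (isClass ∘ inj₂))
        (sym (count-zero k _ (λ g → isClass≡false (inj₁ g) (λ c≢ε → empty g (c≢ε ∘ cong inj₁))))))
        classes≡k

  thin-classes≡0 : ∀ i a g₀ → Local.classes (i , a) (inj₁ g₀) ≡ 0
  thin-classes≡0 i a g₀ = classes≡0 (λ c c≢ε → pairs≡0 c (λ y z y∈S z∈S y-c-z →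
      c≢ε (trans (sym y-c-z) (trans (cong₂ col (unique y∈S) (unique z∈S))
                                    (from col≡inj₁⇔ (refl , identityʳ _))))))
    where
    open Local (i , a) (inj₁ g₀)
    open LocalProperties (i , a) (inj₁ g₀)

    unique : ∀ {y} → inS y ≡ true → y ≡ (i , a ∙ g₀)
    unique {j , b} y∈S =
      let (i≡j , a∙g₀≡b) = to col≡inj₁⇔ (to inS⇔ y∈S) in cong₂ _,_ (sym i≡j) (sym a∙g₀≡b)

  module Symmetric (B-sym : ∀ j l → j ≢ l → B l j ≡ B j l ⁻¹) where

    col-transpose : ∀ {j l b c h} → col (j , b) (l , c) ≡ inj₂ h → col (l , c) (j , b) ≡ inj₂ (h ⁻¹)
    col-transpose {j} {l} {b} {c} {h} j-h-l =
      let (j≢l , b∙h∙B≡c) = to col≡inj₂⇔ j-h-l in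
      from col≡inj₂⇔ (j≢l ∘ sym , (begin
        c ∙ h ⁻¹ ∙ B l j               ≡⟨ cong₂ (λ u v → u ∙ h ⁻¹ ∙ v) (sym b∙h∙B≡c) (B-sym j l j≢l) ⟩
        b ∙ h ∙ B j l ∙ h ⁻¹ ∙ B j l ⁻¹ ≡⟨ x∙y∙z∙y⁻¹∙z⁻¹≡x b h (B j l) ⟩
        b                              ∎))

    module TensorIso (i : Fin m) (a g₀ : Fin k) where
      open Local (i , a) (inj₂ g₀)
      open LocalProperties (i , a) (inj₂ g₀)

      inS⇔fibre : ∀ {j b} → inS (j , b) ≡ true ⇔ (i ≢ j × a ∙ g₀ ∙ B i j ≡ b)
      inS⇔fibre = col≡inj₂⇔ ⇔-∘ inS⇔

      fibre-point∈S : ∀ {j} → j ≢ i → inS (j , a ∙ g₀ ∙ B i j) ≡ true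
      fibre-point∈S j≢i = from inS⇔fibre (j≢i ∘ sym , refl)

      fibre-unique : ∀ {j b c} → inS (j , b) ≡ true → inS (j , c) ≡ true → b ≡ c
      fibre-unique b∈S c∈S = trans (sym (proj₂ (to inS⇔fibre b∈S))) (proj₂ (to inS⇔fibre c∈S))

      pairs-inj₁≡0 : ∀ g → g ≢ ε → pairs (inj₁ g) ≡ 0
      pairs-inj₁≡0 g g≢ε = pairs≡0 (inj₁ g) no-pair
        where
        no-pair : ∀ y z → inS y ≡ true → inS z ≡ true → col y z ≢ inj₁ g
        no-pair (j , b) (l , c) y∈S z∈S y-g-z with to col≡inj₁⇔ y-g-z
        ... | refl , b∙g≡c = g≢ε (identityʳ-unique b g (trans b∙g≡c (fibre-unique z∈S y∈S)))

      SX-≡ : ∀ {y z} {y∈S : inS y ≡ true} {z∈S : inS z ≡ true} → y ≡ z → _≡_ {A = SX} (y , y∈S) (z , z∈S)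
      SX-≡ {y} {y∈S = y∈S} {z∈S} refl = cong (y ,_) (Decidable⇒UIP.≡-irrelevant Bool._≟_ y∈S z∈S)

      fibre : Pt → Fin m
      fibre nothing               = i
      fibre (just ((j , _) , _)) = j

      twist : Pt → Fin k
      twist nothing               = ε
      twist (just ((j , _) , _)) = B i j

      fibre-injective : ∀ {p q} → fibre p ≡ fibre q → p ≡ q
      fibre-injective {nothing} {nothing} _ = refl
      fibre-injective {nothing} {just ((l , c) , c∈S)} i≡l =
        contradiction i≡l (proj₁ (to inS⇔fibre c∈S))
      fibre-injective {just ((j , b) , b∈S)} {nothing} j≡i =
        contradiction (sym j≡i) (proj₁ (to inS⇔fibre b∈S))
      fibre-injective {just ((j , b) , b∈S)} {just ((l , c) , c∈S)} refl =
        cong just (SX-≡ (cong (j ,_) (fibre-unique b∈S c∈S)))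

      from-W : W → Vtx
      from-W (p , β) = fibre p , β ∙ twist p

      to-W : Vtx → W
      to-W (j , b) with j ≟ i
      ... | yes _   = nothing , b
      ... | no j≢i = just ((j , a ∙ g₀ ∙ B i j) , fibre-point∈S j≢i) , b ∙ B i j ⁻¹

      from-W∘to-W : ∀ u → from-W (to-W u) ≡ u
      from-W∘to-W (j , b) with j ≟ i
      ... | yes refl = cong (i ,_) (identityʳ b)
      ... | no _     = cong (j ,_) (//-rightDividesˡ (B i j) b)

      to-W∘from-W : ∀ w → to-W (from-W w) ≡ w
      to-W∘from-W (nothing , β) with i ≟ i
      ... | yes _  = cong (nothing ,_) (identityʳ β)
      ... | no i≢i = contradiction refl i≢i
      to-W∘from-W (just ((j , b) , b∈S) , β) with j ≟ i
      ... | yes j≡i = contradiction (sym j≡i) (proj₁ (to inS⇔fibre b∈S))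
      ... | no _    = cong₂ _,_ (cong just (SX-≡ (cong (j ,_) (proj₂ (to inS⇔fibre b∈S)))))
                                (//-rightDividesʳ (B i j) β)

      L : Fin k → Col
      L g = inj₂ (g ⁻¹)

      open Target L using (Im; Ã; M)

      label : Pt → Pt → Fin k
      label p q = twist p ∙ B (fibre p) (fibre q) ∙ twist q ⁻¹

      Im-refl : ∀ p → Im p p ≡ 1
      Im-refl nothing        = refl
      Im-refl (just (y , _)) = 𝟙-yes (y ≟V y) refl

      Ã-refl : ∀ ℓ p → Ã ℓ p p ≡ 0
      Ã-refl ℓ nothing        = refl
      Ã-refl ℓ (just (y , _)) = 𝟙-no (col y y ≟C L ℓ) (λ e → proj₁ (to col≡inj₂⇔ e) refl)

      Im-offdiag : ∀ {p q} → fibre p ≢ fibre q → Im p q ≡ 0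
      Im-offdiag {nothing}       {nothing}       p≢q = contradiction refl p≢q
      Im-offdiag {nothing}       {just _}        p≢q = refl
      Im-offdiag {just _}        {nothing}       p≢q = refl
      Im-offdiag {just (y , _)}  {just (z , _)}  p≢q = 𝟙-no (y ≟V z) (p≢q ∘ cong proj₁)

      Ã-offdiag : ∀ {p q} → fibre p ≢ fibre q → ∀ ℓ → Ã ℓ p q ≡ 𝟙 (ℓ ≟ label p q)
      Ã-offdiag {nothing} {nothing} p≢q ℓ = contradiction refl p≢q
      Ã-offdiag {nothing} {just ((l , _) , _)} p≢q ℓ =
        cong (λ t → 𝟙 (ℓ ≟ t)) (sym (//-rightDividesʳ (B i l) ε))
      Ã-offdiag {just ((j , _) , b∈S)} {nothing} p≢q ℓ = cong (λ t → 𝟙 (ℓ ≟ t)) (sym (begin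
        B i j ∙ B j i ∙ ε ⁻¹     ≡⟨ cong (λ t → B i j ∙ t ∙ ε ⁻¹) (B-sym i j (proj₁ (to inS⇔fibre b∈S))) ⟩
        B i j ∙ B i j ⁻¹ ∙ ε ⁻¹ ≡⟨ cong₂ _∙_ (inverseʳ (B i j)) ε⁻¹≈ε ⟩
        ε ∙ ε                   ≡⟨ identityʳ ε ⟩
        ε                       ∎))
      Ã-offdiag {just ((j , b) , b∈S)} {just ((l , c) , c∈S)} j≢l ℓ =
        𝟙-⇔ (mk⇔ (λ e → sym (⁻¹-injective (inj₂-injective (trans (sym j-label⁻¹-l) e))))
                 (λ e → trans j-label⁻¹-l (cong (λ t → inj₂ (t ⁻¹)) (sym e))))
            _ _
        where
        j-label⁻¹-l : col (j , b) (l , c) ≡ inj₂ (label (just ((j , b) , b∈S)) (just ((l , c) , c∈S)) ⁻¹)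
        j-label⁻¹-l = from col≡inj₂⇔ (j≢l , (begin
          b ∙ (B i j ∙ B j l ∙ B i l ⁻¹) ⁻¹ ∙ B j l
            ≡⟨ cong (λ t → t ∙ (B i j ∙ B j l ∙ B i l ⁻¹) ⁻¹ ∙ B j l) (sym (proj₂ (to inS⇔fibre b∈S))) ⟩
          a ∙ g₀ ∙ B i j ∙ (B i j ∙ B j l ∙ B i l ⁻¹) ⁻¹ ∙ B j l
            ≡⟨ x∙y∙[y∙z∙w⁻¹]⁻¹∙z≡x∙w (a ∙ g₀) (B i j) (B j l) (B i l) ⟩
          a ∙ g₀ ∙ B i l
            ≡⟨ proj₂ (to inS⇔fibre c∈S) ⟩
          c ∎))

      M-diag : ∀ c p β β' → M c (p , β) (p , β') ≡ AX c (from-W (p , β)) (from-W (p , β'))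
      M-diag (inj₁ g) p β β' = begin
        Im p p * 𝟙 (β ∙ g ≟ β') ≡⟨ cong (_* _) (Im-refl p) ⟩
        1 * 𝟙 (β ∙ g ≟ β')      ≡⟨ *-identityˡ _ ⟩
        𝟙 (β ∙ g ≟ β')          ≡⟨ 𝟙-⇔ same-fibre⇔ _ _ ⟩
        AX (inj₁ g) (from-W (p , β)) (from-W (p , β')) ∎
        where
        same-fibre⇔ : β ∙ g ≡ β' ⇔ col (from-W (p , β)) (from-W (p , β')) ≡ inj₁ g
        same-fibre⇔ = mk⇔
          (λ e → from col≡inj₁⇔ (refl , trans (xy∙z≈xz∙y β (twist p) g) (∙-congʳ e)))
          (λ e → to (x∙z≡y∙z⇔x≡y _ _ (twist p))
                    (trans (sym (xy∙z≈xz∙y β (twist p) g)) (proj₂ (to col≡inj₁⇔ e))))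
      M-diag (inj₂ g) p β β' = trans (sumℕ-zero k _ (λ ℓ → cong (_* _) (Ã-refl ℓ p)))
                                     (sym (𝟙-no _ (λ e → proj₁ (to col≡inj₂⇔ e) refl)))

      M-offdiag : ∀ {p q} → fibre p ≢ fibre q →
                  ∀ c β β' → M c (p , β) (q , β') ≡ AX c (from-W (p , β)) (from-W (q , β'))
      M-offdiag {p} {q} p≢q (inj₁ g) β β' =
        trans (cong (_* _) (Im-offdiag {p} {q} p≢q)) (sym (𝟙-no _ (p≢q ∘ proj₁ ∘ to col≡inj₁⇔)))
      M-offdiag {p} {q} p≢q (inj₂ g) β β' = begin
        sumℕ k (λ ℓ → Ã ℓ p q * P (g ∙ ℓ) β β')
          ≡⟨ sumℕ-cong k (λ ℓ → cong (_* _) (Ã-offdiag {p} {q} p≢q ℓ)) ⟩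
        sumℕ k (λ ℓ → 𝟙 (ℓ ≟ label p q) * P (g ∙ ℓ) β β')
          ≡⟨ sumℕ-𝟙 k _ (label p q) ⟩
        𝟙 (β ∙ (g ∙ label p q) ≟ β')
          ≡⟨ 𝟙-⇔ other-fibre⇔ _ _ ⟩
        AX (inj₂ g) (from-W (p , β)) (from-W (q , β')) ∎
        where
        open Target L using (P)
        shuffle : β ∙ twist p ∙ g ∙ B (fibre p) (fibre q) ≡ β ∙ (g ∙ label p q) ∙ twist q
        shuffle = x∙y∙z∙w≡x∙[z∙[y∙w∙u⁻¹]]∙u β (twist p) g (B (fibre p) (fibre q)) (twist q)
        other-fibre⇔ : β ∙ (g ∙ label p q) ≡ β' ⇔ col (from-W (p , β)) (from-W (q , β')) ≡ inj₂ g
        other-fibre⇔ = mk⇔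
          (λ e → from col≡inj₂⇔ (p≢q , trans shuffle (∙-congʳ e)))
          (λ e → to (x∙z≡y∙z⇔x≡y _ _ (twist q)) (trans (sym shuffle) (proj₂ (to col≡inj₂⇔ e))))

      M≡AX∘from-W : ∀ c w w' → M c w w' ≡ AX c (from-W w) (from-W w')
      M≡AX∘from-W c (p , β) (q , β') = by-fibres (fibre p ≟ fibre q)
        where
        by-fibres : Dec (fibre p ≡ fibre q) →
                    M c (p , β) (q , β') ≡ AX c (from-W (p , β)) (from-W (q , β'))
        by-fibres (yes p≡q) with refl ← fibre-injective {p} {q} p≡q = M-diag c p β β'
        by-fibres (no p≢q) = M-offdiag p≢q c β β'

      labelling : classes ≡ k → IsLabelling L
      labelling classes≡k =
          (λ g h e → ⁻¹-injective (inj₂-injective e))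
        , (λ g → (λ ()) , classes≡k⇒pairs≢0 pairs-inj₁≡0 classes≡k (g ⁻¹))
        , onto
        , (λ g y z _ _ → col-transpose)
        where
        onto : ∀ c → c ≢ inj₁ ε → pairs c ≢ 0 → ∃[ g ] L g ≡ c
        onto (inj₁ g) c≢ε pairs≢0 = contradiction (pairs-inj₁≡0 g (c≢ε ∘ cong inj₁)) pairs≢0
        onto (inj₂ h) _   _       = h ⁻¹ , cong inj₂ (⁻¹-involutive h)

      isoToTensor : classes ≡ k → IsoToTensor
      isoToTensor classes≡k =
        L , labelling classes≡k , mk↔ₛ′ to-W from-W to-W∘from-W from-W∘to-W , ↔-id Col , preserves
        where
        preserves : ∀ c u v → AX c u v ≡ M c (to-W u) (to-W v)
        preserves c u v = sym (trans (M≡AX∘from-W c (to-W u) (to-W v))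
                                     (cong₂ (AX c) (from-W∘to-W u) (from-W∘to-W v)))

theorem5p3 : {m k : ℕ} (G : FinAbGroup k) (B : Fin m → Fin m → Fin k) →
    Roux.IsRouxMatrix G B →
    (x : Roux.Vtx G B) (s : Roux.Col G B) →
    Roux.Thick G B s →
    Roux.Local.IsLocalScheme G B x s →
    Roux.Local.classes G B x s ≡ k →
    Roux.Local.IsoToTensor G B x s
theorem5p3 G B _ (i , a) (inj₁ g₀) _ _ classes≡k =
  contradiction (subst Fin (trans (sym classes≡k) (thin-classes≡0 i a g₀)) (FinAbGroup.ε G)) ¬Fin0
  where open RouxProperties G B
theorem5p3 G B (B-sym , _) (i , a) (inj₂ g₀) _ _ classes≡k = isoToTensor classes≡k
  where open RouxProperties.Symmetric.TensorIso G B B-sym i a g₀
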